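{- Consider the undirected graph with vertex set $\{0,1,2,3,4,5,6\}$ and edge set $\{\{0,1\},\{0,2\},\{0,3\},\{3,4\},\{4,5\},\{4,6\}\}$ (node $0$ is the start node and node $6$ is the target node). Let $T_{task}^{\pi}$ denote the first time $n\ge 1$ with $X_n=6$ for the walk $(X_n)_{n\ge0}$ with $X_0=0$ governed by policy $\pi$. Then $$\mathbb E[T_{task}^{\pi_{neg}}] < \mathbb E[T_{task}^{\pi_{rw}}] = 23 .$$
   Context: The graph encodes a $3\times 3$ grid world in which two cells are inaccessible: node 0 is the "Start" cell (middle-left), 1 the upper-left, 2 the bottom-left, 3 the middle, 4 the middle-right, 5 the upper-right cell and 6 the "End" cell (bottom-right); edges join accessible adjacent cells. Random walk policy $\pi_{rw}$: if $X_n=i$, then $X_{n+1}$ is chosen uniformly at random among the neighbours of $i$, independently of the past. Negative feedback policy $\pi_{neg}$: for nodes $i,j$ with $\{i,j\}$ an edge, let $N_{ij}^{(n)}$ be the number of times $m<n$ with $X_m=i, X_{m+1}=j$ (so $N_{ij}^{(0)}=0$). Let $Nmin_i^{(n)}=\min_{j:\{i,j\}\text{ edge}} N_{ij}^{(n)}$, $Smin_i^{(n)}=\{j:\{i,j\}\text{ an edge},\ N_{ij}^{(n)}=Nmin_i^{(n)}\}$, and $Kmin_i^{(n)}=|Smin_i^{(n)}|$. If $X_n=i$, then given the whole past $X_0,\dots,X_n$, $X_{n+1}$ is chosen uniformly at random from $Smin_i^{(n)}$, i.e. with probability $1/Kmin_i^{(n)}$ for each $j\in Smin_i^{(n)}$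 and probability $0$ otherwise. -}

module Defs where

open import Data.Nat as ℕ using (ℕ; zero; suc)
open import Data.Fin using (Fin; zero; suc)
open import Data.Fin.Properties using () renaming (_≟_ to _≟ᶠ_)
open import Data.Bool using (Bool; true; false; if_then_else_; _∧_)
open import Data.List using (List; []; _∷_; _++_; [_]; filter; length; foldr; map)
open import Data.List.Base using (allFin)
open import Data.Integer using (+_)
open import Data.Rational using (ℚ; 0ℚ; 1ℚ; _+_; _*_; _/_)
open import Relation.Nullary using (Dec; yes; no; ¬_)
open import Relation.Nullary.Decidable using (⌊_⌋)

Node : Set
Node = Fin 7

start target : Node
start = zero
target = suc (suc (suc (suc (suc (suc zero)))))

n0 n1 n2 n3 n4 n5 n6 : Node
n0 = zero
n1 = suc zero
n2 = suc (suc zero)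
n3 = suc (suc (suc zero))
n4 = suc (suc (suc (suc zero)))
n5 = suc (suc (suc (suc (suc zero))))
n6 = target

neighbours : Node → List Node
neighbours zero = n1 ∷ n2 ∷ n3 ∷ []
neighbours (suc zero) = n0 ∷ []
neighbours (suc (suc zero)) = n0 ∷ []
neighbours (suc (suc (suc zero))) = n0 ∷ n4 ∷ []
neighbours (suc (suc (suc (suc zero)))) = n3 ∷ n5 ∷ n6 ∷ []
neighbours (suc (suc (suc (suc (suc zero))))) = n4 ∷ []
neighbours (suc (suc (suc (suc (suc (suc zero)))))) = n4 ∷ []

_==_ : Node → Node → Bool
i == j = ⌊ i ≟ᶠ j ⌋

elem : Node → List Node → Bool
elem j [] = false
elem j (x ∷ xs) = if j == x then true else elem j xs

-- 1/k as a rational (k = 0 never arises: every node has a neighbour).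
inv : ℕ → ℚ
inv zero = 0ℚ
inv (suc k) = + 1 / suc k

-- A history-dependent policy: given the current node X_n and the full
-- trajectory (X_0, …, X_n) (as a list, oldest first), the probability
-- of moving to node j.
Policy : Set
Policy = Node → List Node → Node → ℚ

πrw : Policy
πrw i hist j = if elem j (neighbours i) then inv (length (neighbours i)) else 0ℚ

countTrans : Node → Node → List Node → ℕ
countTrans i j [] = 0
countTrans i j (x ∷ []) = 0
countTrans i j (x ∷ y ∷ xs) =
  (if (x == i) ∧ (y == j) then 1 else 0) ℕ.+ countTrans i j (y ∷ xs)

minList : List ℕ → ℕ
minList [] = 0
minList (x ∷ []) = x
minList (x ∷ y ∷ xs) = x ℕ.⊓ minList (y ∷ xs)

Nmin : Node → List Node → ℕ
Nmin i hist = minList (map (λ j → countTrans i j hist) (neighbours i))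

Smin : Node → List Node → List Node
Smin i hist = filter (λ j → countTrans i j hist ℕ.≟ Nmin i hist) (neighbours i)

πneg : Policy
πneg i hist j = if elem j (Smin i hist) then inv (length (Smin i hist)) else 0ℚ

sumℚ : List ℚ → ℚ
sumℚ = foldr _+_ 0ℚ

-- survive π cur hist k = probability that, continuing from the trajectory
-- hist (whose last entry is cur), the next k positions all differ from the target.
survive : Policy → Node → List Node → ℕ → ℚ
survive π cur hist zero = 1ℚ
survive π cur hist (suc k) =
  sumℚ (map (λ j → if j == target then 0ℚ
                    else π cur hist j * survive π j (hist ++ [ j ]) k)
            (allFin 7))

-- P(T_task > n) for the walk started at X_0 = start (T_task = first n ≥ 1 with X_n = 6).
tailProb : Policy → ℕ → ℚ
tailProb π n = survive π start [ start ] n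

-- Partial sums Σ_{n<N} P(T > n); E[T] = sup_N of these (= Σ_{n≥0} P(T>n)).
partialExp : Policy → ℕ → ℚ
partialExp π zero = 0ℚ
partialExp π (suc N) = partialExp π N + tailProb π N

{-# OPTIONS --safe #-}
-- Under the random walk, the survival probabilities are the iterates Pⁿ 1 of the
-- substochastic matrix P of the walk killed on entering node 6, and the expected
-- hitting times h solve the Poisson equation h = 1 + P h, with h(0) = 23.
-- Telescoping gives Σ_{n<N} Pⁿ 1 + P^N h = h, so the partial sums of E[T] are
-- at most 23 and miss it by exactly the remainder P^N h(0). The remainders decrease,
-- and their sums are bounded by g(0) = 468 for the nonnegative solution g of
-- g = h + P g, so they eventually drop below any ε > 0.
-- Under negative feedback, exact evaluation shows that every trajectory reaches
-- the target within 23 steps and that the partial sums stabilise at 13.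
module Submission where

open import Defs
open import Data.Nat using (ℕ)
open import Data.Product using (_×_; ∃)
open import Data.Integer using (+_)
open import Data.Rational using (ℚ; 0ℚ; _<_; _≤_; _-_; _/_)

open import Algebra.Bundles using (CommutativeMonoid)
open import Data.Bool using (true; false; if_then_else_)
open import Data.Empty using (⊥-elim)
open import Data.Fin.Properties using (all?)
open import Data.Integer using (+[1+_]; -[1+_]; +<+)
import Data.Integer as ℤ
import Data.Integer.Properties as ℤₚ
import Data.Integer.Solver as ℤ-Solver
open import Data.List using (List; []; _∷_; _++_; [_]; map; length)
open import Data.List.Base using (allFin)
import Data.Nat as ℕ
import Data.Nat.Properties as ℕₚ
open import Data.Product using (_,_; map₂)
open import Data.Rational using (mkℚ; ↥_; 1ℚ; nonNegative; _+_; _*_; -_; toℚᵘ)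
open import Data.Rational.Literals using (fromℤ)
open import Data.Rational.Properties
  using (_≟_; _≤?_; _<?_; ≤-refl; ≤-trans; <-≤-trans; <-irrefl; ≰⇒>; +-mono-≤; +-monoˡ-≤; +-monoʳ-≤;
         +-monoʳ-<; +-assoc; +-inverseʳ; +-identityˡ; +-identityʳ; *-zeroˡ; *-zeroʳ; *-distribˡ-+;
         *-monoˡ-≤-nonNeg; neg-antimono-<; nonNegative⁻¹; normalize-nonNeg;
         +-0-commutativeMonoid; toℚᵘ-homo-+; toℚᵘ-cancel-<; drop-*<*)
open import Data.Rational.Unnormalised using (mkℚᵘ; _≃_; *≡*; *<*)
import Data.Rational.Unnormalised.Properties as ℚᵘₚ
open import Data.Vec using (_∷_; []; lookup)
open import Function using (const)
open import Relation.Nullary.Decidable using (⌊_⌋; yes; no; from-yes)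
open import Relation.Binary.PropositionalEquality
  using (_≡_; refl; sym; trans; cong; cong₂; subst; subst₂; module ≡-Reasoning)
open import Algebra.Properties.CommutativeSemigroup
  (CommutativeMonoid.commutativeSemigroup +-0-commutativeMonoid) using (interchange)

p≤p+q : ∀ p {q} → 0ℚ ≤ q → p ≤ p + q
p≤p+q p {q} 0≤q = subst (_≤ p + q) (+-identityʳ p) (+-monoʳ-≤ p 0≤q)

p≤q+p : ∀ p {q} → 0ℚ ≤ q → p ≤ q + p
p≤q+p p {q} 0≤q = subst (_≤ q + p) (+-identityˡ p) (+-monoˡ-≤ p 0≤q)

p*q-nonNeg : ∀ {p q} → 0ℚ ≤ p → 0ℚ ≤ q → 0ℚ ≤ p * q
p*q-nonNeg {p} {q} 0≤p 0≤q =
  subst (_≤ p * q) (*-zeroʳ p) (*-monoˡ-≤-nonNeg p {{nonNegative 0≤p}} 0≤q)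

p+q≡r⇒r-ε<p : ∀ {p q r ε} → p + q ≡ r → q < ε → r - ε < p
p+q≡r⇒r-ε<p {p} {q} {r} {ε} p+q≡r q<ε =
  subst₂ _<_ (cong (_- ε) p+q≡r) p+q-q≡p (+-monoʳ-< (p + q) (neg-antimono-< q<ε))
  where
  open ≡-Reasoning
  p+q-q≡p : p + q - q ≡ p
  p+q-q≡p = begin
    p + q - q     ≡⟨ +-assoc p q (- q) ⟩
    p + (q - q)   ≡⟨ cong (_+_ p) (+-inverseʳ q) ⟩
    p + 0ℚ        ≡⟨ +-identityʳ p ⟩
    p             ∎

Σ< : (ℕ → ℚ) → ℕ → ℚ
Σ< a ℕ.zero = 0ℚ
Σ< a (ℕ.suc n) = Σ< a n + a n

Σ<-cong : ∀ {a b} → (∀ n → a n ≡ b n) → ∀ N → Σ< a N ≡ Σ< b N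
Σ<-cong a≡b ℕ.zero = refl
Σ<-cong a≡b (ℕ.suc N) = cong₂ _+_ (Σ<-cong a≡b N) (a≡b N)

Σ<-mono : ∀ {a b} → (∀ n → a n ≤ b n) → ∀ N → Σ< a N ≤ Σ< b N
Σ<-mono a≤b ℕ.zero = ≤-refl
Σ<-mono a≤b (ℕ.suc N) = +-mono-≤ (Σ<-mono a≤b N) (a≤b N)

antitone⇒Σ<-const≤Σ< : ∀ {a} → (∀ n → a (ℕ.suc n) ≤ a n) → ∀ M → Σ< (const (a M)) M ≤ Σ< a M
antitone⇒Σ<-const≤Σ< a↓ ℕ.zero = ≤-refl
antitone⇒Σ<-const≤Σ< a↓ (ℕ.suc M) =
  +-mono-≤ (≤-trans (Σ<-mono (λ _ → a↓ M) M) (antitone⇒Σ<-const≤Σ< a↓ M)) (a↓ M)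

toℚᵘ-Σ<-const : ∀ M ε → toℚᵘ (Σ< (const ε) M) ≃ mkℚᵘ (+ M ℤ.* ↥ ε) (ℚ.denominator-1 ε)
toℚᵘ-Σ<-const ℕ.zero ε@record{} = *≡* refl
toℚᵘ-Σ<-const (ℕ.suc M) ε@(mkℚ n d _) =
  ℚᵘₚ.≃-trans (toℚᵘ-homo-+ (Σ< (const ε) M) ε)
    (ℚᵘₚ.≃-trans (ℚᵘₚ.+-congˡ (mkℚᵘ n d) (toℚᵘ-Σ<-const M ε))
      (*≡* (trans (same-denominator-sum (+ M) n (+ ℕ.suc d))
                  (cong ((+ ℕ.suc M ℤ.* n) ℤ.*_) (sym (ℤₚ.pos-* (ℕ.suc d) (ℕ.suc d)))))))
  where
  same-denominator-sum : ∀ m n d →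
    ((m ℤ.* n) ℤ.* d ℤ.+ n ℤ.* d) ℤ.* d ≡ ((ℤ.1ℤ ℤ.+ m) ℤ.* n) ℤ.* (d ℤ.* d)
  same-denominator-sum = solve 3 (λ m n d →
    ((m :* n) :* d :+ n :* d) :* d := ((con ℤ.1ℤ :+ m) :* n) :* (d :* d)) refl
    where open ℤ-Solver.+-*-Solver

-- Stated with fromℤ (+ K): for a variable K, + K / 1 normalises through gcd and is stuck.
archimedean : ∀ K ε → 0ℚ < ε → ∃ λ M → fromℤ (+ K) < Σ< (const ε) M
archimedean K ε@(mkℚ +[1+ n ] d _) _ =
  M , toℚᵘ-cancel-< (ℚᵘₚ.<-respʳ-≃ (ℚᵘₚ.≃-sym (toℚᵘ-Σ<-const M ε)) (*<* K*D<M*N))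
  where
  M : ℕ
  M = ℕ.suc K ℕ.* ℕ.suc d
  K*D<M*N : + K ℤ.* + ℕ.suc d ℤ.< (+ M ℤ.* +[1+ n ]) ℤ.* ℤ.1ℤ
  K*D<M*N = subst₂ ℤ._<_ (ℤₚ.pos-* K (ℕ.suc d))
                         (trans (ℤₚ.pos-* M (ℕ.suc n)) (sym (ℤₚ.*-identityʳ _)))
                         (+<+ (ℕₚ.<-≤-trans (ℕₚ.*-monoˡ-< (ℕ.suc d) (ℕₚ.n<1+n K))
                                             (ℕₚ.m≤m*n M (ℕ.suc n))))
archimedean K (mkℚ (+ 0) _ _) 0<ε with drop-*<* 0<ε
... | +<+ ()
archimedean K (mkℚ -[1+ _ ] _ _) 0<ε with drop-*<* 0<ε
... | ()

antitone-summable⇒tail< : ∀ {a} K → (∀ n → a (ℕ.suc n) ≤ a n) → (∀ M → Σ< a M ≤ fromℤ (+ K)) →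
                           ∀ ε → 0ℚ < ε → ∃ λ M → a M < ε
antitone-summable⇒tail< {a} K a↓ Σa≤K ε 0<ε with archimedean K ε 0<ε
... | M , K<Mε with ε ≤? a M
...   | no ε≰aM = M , ≰⇒> ε≰aM
...   | yes ε≤aM = ⊥-elim (<-irrefl refl (<-≤-trans K<Mε Mε≤K))
  where
  Mε≤K : Σ< (const ε) M ≤ fromℤ (+ K)
  Mε≤K = ≤-trans (Σ<-mono (λ _ → ε≤aM) M) (≤-trans (antitone⇒Σ<-const≤Σ< a↓ M) (Σa≤K M))

sumℚ-cong : ∀ {A : Set} {f g : A → ℚ} → (∀ x → f x ≡ g x) → ∀ xs → sumℚ (map f xs) ≡ sumℚ (map g xs)
sumℚ-cong f≡g [] = refl
sumℚ-cong f≡g (x ∷ xs) = cong₂ _+_ (f≡g x) (sumℚ-cong f≡g xs)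

sumℚ-+ : ∀ {A : Set} (f g : A → ℚ) xs →
         sumℚ (map (λ x → f x + g x) xs) ≡ sumℚ (map f xs) + sumℚ (map g xs)
sumℚ-+ f g [] = refl
sumℚ-+ f g (x ∷ xs) =
  trans (cong (_+_ (f x + g x)) (sumℚ-+ f g xs)) (interchange (f x) (g x) _ _)

sumℚ-nonNeg : ∀ {A : Set} {f : A → ℚ} → (∀ x → 0ℚ ≤ f x) → ∀ xs → 0ℚ ≤ sumℚ (map f xs)
sumℚ-nonNeg 0≤f [] = ≤-refl
sumℚ-nonNeg 0≤f (x ∷ xs) = +-mono-≤ (0≤f x) (sumℚ-nonNeg 0≤f xs)

if-nonNeg : ∀ b {x y} → 0ℚ ≤ x → 0ℚ ≤ y → 0ℚ ≤ (if b then x else y)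
if-nonNeg true 0≤x 0≤y = 0≤x
if-nonNeg false 0≤x 0≤y = 0≤y

NonNegativePolicy : Policy → Set
NonNegativePolicy π = ∀ i hist j → 0ℚ ≤ π i hist j

survive-nonNeg : ∀ {π} → NonNegativePolicy π → ∀ k cur hist → 0ℚ ≤ survive π cur hist k
survive-nonNeg 0≤π ℕ.zero cur hist = nonNegative⁻¹ 1ℚ
survive-nonNeg 0≤π (ℕ.suc k) cur hist =
  sumℚ-nonNeg (λ j → if-nonNeg (j == target) ≤-refl
                        (p*q-nonNeg (0≤π cur hist j) (survive-nonNeg 0≤π k j (hist ++ [ j ]))))
              (allFin 7)

partialExp≡Σ<tailProb : ∀ π N → partialExp π N ≡ Σ< (tailProb π) N
partialExp≡Σ<tailProb π ℕ.zero = refl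
partialExp≡Σ<tailProb π (ℕ.suc N) = cong (_+ tailProb π N) (partialExp≡Σ<tailProb π N)

partialExp-mono : ∀ π → NonNegativePolicy π → ∀ N m → partialExp π N ≤ partialExp π (m ℕ.+ N)
partialExp-mono π 0≤π N ℕ.zero = ≤-refl
partialExp-mono π 0≤π N (ℕ.suc m) =
  ≤-trans (partialExp-mono π 0≤π N m) (p≤p+q _ (survive-nonNeg 0≤π (m ℕ.+ N) start [ start ]))

partialExp-stable : ∀ π N₀ → (∀ m → tailProb π (N₀ ℕ.+ m) ≡ 0ℚ) →
                    ∀ m → partialExp π (N₀ ℕ.+ m) ≡ partialExp π N₀
partialExp-stable π N₀ tail≡0 ℕ.zero = cong (partialExp π) (ℕₚ.+-identityʳ N₀)
partialExp-stable π N₀ tail≡0 (ℕ.suc m) = begin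
  partialExp π (N₀ ℕ.+ ℕ.suc m)
    ≡⟨ cong (partialExp π) (ℕₚ.+-suc N₀ m) ⟩
  partialExp π (N₀ ℕ.+ m) + tailProb π (N₀ ℕ.+ m)
    ≡⟨ cong₂ _+_ (partialExp-stable π N₀ tail≡0 m) (tail≡0 m) ⟩
  partialExp π N₀ + 0ℚ
    ≡⟨ +-identityʳ _ ⟩
  partialExp π N₀ ∎
  where open ≡-Reasoning

partialExp≤stable : ∀ π N₀ → NonNegativePolicy π → (∀ m → tailProb π (N₀ ℕ.+ m) ≡ 0ℚ) →
                    ∀ N → partialExp π N ≤ partialExp π N₀
partialExp≤stable π N₀ 0≤π tail≡0 N =
  subst (partialExp π N ≤_) (partialExp-stable π N₀ tail≡0 N) (partialExp-mono π 0≤π N N₀)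

uniformOn : List Node → Node → ℚ
uniformOn S j = if elem j S then inv (length S) else 0ℚ

uniformOn-nonNeg : ∀ S j → 0ℚ ≤ uniformOn S j
uniformOn-nonNeg S j = if-nonNeg (elem j S) (inv-nonNeg (length S)) ≤-refl
  where
  inv-nonNeg : ∀ k → 0ℚ ≤ inv k
  inv-nonNeg ℕ.zero = ≤-refl
  inv-nonNeg (ℕ.suc k) = nonNegative⁻¹ _ {{normalize-nonNeg 1 (ℕ.suc k)}}

IsUniformOn : (Node → List Node → List Node) → Policy → Set
IsUniformOn support π = ∀ i hist j → π i hist j ≡ uniformOn (support i hist) j

uniform-nonNeg : ∀ support {π} → IsUniformOn support π → NonNegativePolicy π
uniform-nonNeg support π≡ i hist j =
  subst (0ℚ ≤_) (sym (π≡ i hist j)) (uniformOn-nonNeg (support i hist) j)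

Kernel : Set
Kernel = Node → Node → ℚ

memoryless : Kernel → Policy
memoryless p i _ = p i

module _ (p : Kernel) where

  killed : (Node → ℚ) → Node → ℚ
  killed v i = sumℚ (map (λ j → if j == target then 0ℚ else p i j * v j) (allFin 7))

  killedⁿ : ℕ → (Node → ℚ) → Node → ℚ
  killedⁿ ℕ.zero v = v
  killedⁿ (ℕ.suc n) v = killed (killedⁿ n v)

  Poisson : (w f : Node → ℚ) → Set
  Poisson w f = ∀ i → f i ≡ w i + killed f i

  killed-cong : ∀ {u v} → (∀ j → u j ≡ v j) → ∀ i → killed u i ≡ killed v i
  killed-cong u≡v i =
    sumℚ-cong (λ j → cong (λ x → if j == target then 0ℚ else p i j * x) (u≡v j)) (allFin 7)

  killed-+ : ∀ u v i → killed (λ j → u j + v j) i ≡ killed u i + killed v i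
  killed-+ u v i =
    trans (sumℚ-cong (λ j → guarded-distrib (j == target) (p i j) (u j) (v j)) (allFin 7))
          (sumℚ-+ (λ j → if j == target then 0ℚ else p i j * u j)
                  (λ j → if j == target then 0ℚ else p i j * v j) (allFin 7))
    where
    guarded-distrib : ∀ b q x y → (if b then 0ℚ else q * (x + y))
                                  ≡ (if b then 0ℚ else q * x) + (if b then 0ℚ else q * y)
    guarded-distrib true q x y = refl
    guarded-distrib false q x y = *-distribˡ-+ q x y

  killedⁿ-cong : ∀ {u v} → (∀ j → u j ≡ v j) → ∀ n i → killedⁿ n u i ≡ killedⁿ n v i
  killedⁿ-cong u≡v ℕ.zero i = u≡v i
  killedⁿ-cong u≡v (ℕ.suc n) = killed-cong (killedⁿ-cong u≡v n)

  killedⁿ-+ : ∀ u v n i → killedⁿ n (λ j → u j + v j) i ≡ killedⁿ n u i + killedⁿ n v i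
  killedⁿ-+ u v ℕ.zero i = refl
  killedⁿ-+ u v (ℕ.suc n) i =
    trans (killed-cong (killedⁿ-+ u v n) i) (killed-+ (killedⁿ n u) (killedⁿ n v) i)

  killedⁿ-killed : ∀ v n i → killedⁿ n (killed v) i ≡ killedⁿ (ℕ.suc n) v i
  killedⁿ-killed v ℕ.zero i = refl
  killedⁿ-killed v (ℕ.suc n) = killed-cong (killedⁿ-killed v n)

  survive-memoryless : ∀ k cur hist → survive (memoryless p) cur hist k ≡ killedⁿ k (const 1ℚ) cur
  survive-memoryless ℕ.zero cur hist = refl
  survive-memoryless (ℕ.suc k) cur hist =
    killed-cong (λ j → survive-memoryless k j (hist ++ [ j ])) cur

  module _ {w f} (poisson : Poisson w f) where

    killedⁿ-poisson : ∀ n i → killedⁿ n f i ≡ killedⁿ n w i + killedⁿ (ℕ.suc n) f i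
    killedⁿ-poisson n i = begin
      killedⁿ n f i                            ≡⟨ killedⁿ-cong poisson n i ⟩
      killedⁿ n (λ j → w j + killed f j) i     ≡⟨ killedⁿ-+ w (killed f) n i ⟩
      killedⁿ n w i + killedⁿ n (killed f) i   ≡⟨ cong (_+_ (killedⁿ n w i)) (killedⁿ-killed f n i) ⟩
      killedⁿ n w i + killedⁿ (ℕ.suc n) f i    ∎
      where open ≡-Reasoning

    Σ<-killedⁿ-telescope : ∀ N i → Σ< (λ n → killedⁿ n w i) N + killedⁿ N f i ≡ f i
    Σ<-killedⁿ-telescope ℕ.zero i = +-identityˡ (f i)
    Σ<-killedⁿ-telescope (ℕ.suc N) i = begin
      (Σ< (λ n → killedⁿ n w i) N + killedⁿ N w i) + killedⁿ (ℕ.suc N) f i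
        ≡⟨ +-assoc (Σ< (λ n → killedⁿ n w i) N) (killedⁿ N w i) (killedⁿ (ℕ.suc N) f i) ⟩
      Σ< (λ n → killedⁿ n w i) N + (killedⁿ N w i + killedⁿ (ℕ.suc N) f i)
        ≡⟨ cong (_+_ (Σ< (λ n → killedⁿ n w i) N)) (sym (killedⁿ-poisson N i)) ⟩
      Σ< (λ n → killedⁿ n w i) N + killedⁿ N f i
        ≡⟨ Σ<-killedⁿ-telescope N i ⟩
      f i ∎
      where open ≡-Reasoning

  module _ (0≤p : ∀ i j → 0ℚ ≤ p i j) where

    killedⁿ-nonNeg : ∀ {v} → (∀ j → 0ℚ ≤ v j) → ∀ n i → 0ℚ ≤ killedⁿ n v i
    killedⁿ-nonNeg 0≤v ℕ.zero i = 0≤v i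
    killedⁿ-nonNeg 0≤v (ℕ.suc n) i =
      sumℚ-nonNeg (λ j → if-nonNeg (j == target) ≤-refl
                            (p*q-nonNeg (0≤p i j) (killedⁿ-nonNeg 0≤v n j)))
                  (allFin 7)

    module _ {w f} (poisson : Poisson w f) where

      Σ<-killedⁿ≤ : (∀ j → 0ℚ ≤ f j) → ∀ N i → Σ< (λ n → killedⁿ n w i) N ≤ f i
      Σ<-killedⁿ≤ 0≤f N i =
        subst (Σ< (λ n → killedⁿ n w i) N ≤_) (Σ<-killedⁿ-telescope poisson N i)
              (p≤p+q _ (killedⁿ-nonNeg 0≤f N i))

      killedⁿ-antitone : (∀ j → 0ℚ ≤ w j) → ∀ n i → killedⁿ (ℕ.suc n) f i ≤ killedⁿ n f i
      killedⁿ-antitone 0≤w n i =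
        subst (killedⁿ (ℕ.suc n) f i ≤_) (sym (killedⁿ-poisson poisson n i))
              (p≤q+p _ (killedⁿ-nonNeg 0≤w n i))

rwKernel : Kernel
rwKernel i = uniformOn (neighbours i)

rwKernel-nonNeg : ∀ i j → 0ℚ ≤ rwKernel i j
rwKernel-nonNeg i = uniformOn-nonNeg (neighbours i)

-- expectedSteps i = E_i[T] and expectedSteps² i = E_i[T (T + 1) / 2] for the random walk
-- from i, where T ≥ 1 is the hitting (for i = 6, return) time of the target.
expectedSteps : Node → ℚ
expectedSteps =
  lookup (+ 23 / 1 ∷ + 24 / 1 ∷ + 24 / 1 ∷ + 18 / 1 ∷ + 11 / 1 ∷ + 12 / 1 ∷ + 12 / 1 ∷ [])

expectedSteps² : Node → ℚ
expectedSteps² =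
  lookup (+ 468 / 1 ∷ + 492 / 1 ∷ + 492 / 1 ∷ + 351 / 1 ∷ + 198 / 1 ∷ + 210 / 1 ∷ + 210 / 1 ∷ [])

expectedSteps-poisson : Poisson rwKernel (const 1ℚ) expectedSteps
expectedSteps-poisson =
  from-yes (all? λ i → expectedSteps i ≟ 1ℚ + killed rwKernel expectedSteps i)

expectedSteps²-poisson : Poisson rwKernel expectedSteps expectedSteps²
expectedSteps²-poisson =
  from-yes (all? λ i → expectedSteps² i ≟ expectedSteps i + killed rwKernel expectedSteps² i)

expectedSteps-nonNeg : ∀ i → 0ℚ ≤ expectedSteps i
expectedSteps-nonNeg = from-yes (all? λ i → 0ℚ ≤? expectedSteps i)

expectedSteps²-nonNeg : ∀ i → 0ℚ ≤ expectedSteps² i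
expectedSteps²-nonNeg = from-yes (all? λ i → 0ℚ ≤? expectedSteps² i)

partialExp-πrw-telescope : ∀ N →
  partialExp πrw N + killedⁿ rwKernel N expectedSteps start ≡ + 23 / 1
partialExp-πrw-telescope N = begin
  partialExp πrw N + killedⁿ rwKernel N expectedSteps start
    ≡⟨ cong (_+ killedⁿ rwKernel N expectedSteps start) (partialExp≡Σ<tailProb πrw N) ⟩
  Σ< (tailProb πrw) N + killedⁿ rwKernel N expectedSteps start
    ≡⟨ cong (_+ killedⁿ rwKernel N expectedSteps start)
            (Σ<-cong (λ n → survive-memoryless rwKernel n start [ start ]) N) ⟩
  Σ< (λ n → killedⁿ rwKernel n (const 1ℚ) start) N + killedⁿ rwKernel N expectedSteps start
    ≡⟨ Σ<-killedⁿ-telescope rwKernel expectedSteps-poisson N start ⟩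
  + 23 / 1 ∎
  where open ≡-Reasoning

-- Unlike _*_, _⊛_ does not evaluate its second argument when the first is 0, so
-- evaluating surviveUniform only explores trajectories of positive probability.
_⊛_ : ℚ → ℚ → ℚ
p ⊛ x = if ⌊ p ≟ 0ℚ ⌋ then 0ℚ else p * x

⊛≡* : ∀ p x → p ⊛ x ≡ p * x
⊛≡* p x with p ≟ 0ℚ
... | yes refl = sym (*-zeroˡ x)
... | no _ = refl

-- The support of the current node is passed on as an argument so that it is computed
-- once per node rather than once per candidate successor.
surviveUniform : (Node → List Node → List Node) → Node → List Node → ℕ → ℚ
surviveUniformOn : (Node → List Node → List Node) → List Node → List Node → ℕ → ℚ
surviveUniform support cur hist ℕ.zero = 1ℚ
surviveUniform support cur hist (ℕ.suc k) = surviveUniformOn support (support cur hist) hist k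
surviveUniformOn support S hist k =
  sumℚ (map (λ j → if j == target then 0ℚ
                   else uniformOn S j ⊛ surviveUniform support j (hist ++ [ j ]) k)
            (allFin 7))

survive≡surviveUniform : ∀ π support → IsUniformOn support π →
                         ∀ k cur hist → survive π cur hist k ≡ surviveUniform support cur hist k
survive≡surviveUniform π support π≡ ℕ.zero cur hist = refl
survive≡surviveUniform π support π≡ (ℕ.suc k) cur hist = sumℚ-cong term≡ (allFin 7)
  where
  S : List Node
  S = support cur hist
  term≡ : ∀ j → (if j == target then 0ℚ else π cur hist j * survive π j (hist ++ [ j ]) k)
              ≡ (if j == target then 0ℚ
                 else uniformOn S j ⊛ surviveUniform support j (hist ++ [ j ]) k)
  term≡ j with j == target
  ... | true = refl
  ... | false =
    trans (cong₂ _*_ (π≡ cur hist j) (survive≡surviveUniform π support π≡ k j (hist ++ [ j ])))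
          (sym (⊛≡* (uniformOn S j) (surviveUniform support j (hist ++ [ j ]) k)))

πneg-uniform : IsUniformOn Smin πneg
πneg-uniform i hist j = refl

πneg-tailProb-23+ : ∀ m → tailProb πneg (23 ℕ.+ m) ≡ 0ℚ
πneg-tailProb-23+ m =
  trans (survive≡surviveUniform πneg Smin πneg-uniform (23 ℕ.+ m) start [ start ]) vanishes
  where
  vanishes : surviveUniform Smin start [ start ] (23 ℕ.+ m) ≡ 0ℚ
  vanishes = refl

partialExp-πneg : ∀ N → partialExp πneg N ≡ Σ< (surviveUniform Smin start [ start ]) N
partialExp-πneg N =
  trans (partialExp≡Σ<tailProb πneg N)
        (Σ<-cong (λ n → survive≡surviveUniform πneg Smin πneg-uniform n start [ start ]) N)

partialExp-πneg-23 : partialExp πneg 23 ≡ + 13 / 1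
partialExp-πneg-23 = trans (partialExp-πneg 23) value
  where
  value : Σ< (surviveUniform Smin start [ start ]) 23 ≡ + 13 / 1
  value = refl

proposition1 : ((N : ℕ) → partialExp πrw N ≤ + 23 / 1)
    × ((ε : ℚ) → 0ℚ < ε → ∃ λ N → (+ 23 / 1) - ε < partialExp πrw N)
    × (∃ λ q → q < + 23 / 1 × ((N : ℕ) → partialExp πneg N ≤ q))
proposition1 =
  πrw-bounded , πrw-approaches , (+ 13 / 1 , from-yes (+ 13 / 1 <? + 23 / 1) , πneg-bounded)
  where
  remainder : ℕ → ℚ
  remainder n = killedⁿ rwKernel n expectedSteps start

  πrw-bounded : ∀ N → partialExp πrw N ≤ + 23 / 1
  πrw-bounded N = subst (partialExp πrw N ≤_) (partialExp-πrw-telescope N)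
                        (p≤p+q _ (killedⁿ-nonNeg rwKernel rwKernel-nonNeg
                                                 expectedSteps-nonNeg N start))

  πrw-approaches : ∀ ε → 0ℚ < ε → ∃ λ N → + 23 / 1 - ε < partialExp πrw N
  πrw-approaches ε 0<ε =
    map₂ (λ {N} → p+q≡r⇒r-ε<p (partialExp-πrw-telescope N))
         (antitone-summable⇒tail< {remainder} 468
           (λ n → killedⁿ-antitone rwKernel rwKernel-nonNeg expectedSteps-poisson
                                   (λ _ → nonNegative⁻¹ 1ℚ) n start)
           (λ M → Σ<-killedⁿ≤ rwKernel rwKernel-nonNeg expectedSteps²-poisson
                              expectedSteps²-nonNeg M start)
           ε 0<ε)

  πneg-bounded : ∀ N → partialExp πneg N ≤ + 13 / 1
  πneg-bounded N = subst (partialExp πneg N ≤_) partialExp-πneg-23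
                         (partialExp≤stable πneg 23 (uniform-nonNeg Smin πneg-uniform)
                                            πneg-tailProb-23+ N)
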